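{- Let $m\ge 1$ be an integer, let $A=\{0,2,4,\dots,2(m-1)\}$, and let $O$ be a set of positive odd integers. Let $O_{rel}=O\cap\left\{\frac{a+b}{2},\frac{|a-b|}{2} : a,b\in A\right\}$. If $|O_{rel}|>\frac{3|A|}{4}$, then the odd-even graph $\mathcal{G}_A(O)$ is connected.
   Context: For a set $A$ of non-negative even integers and a set $O$ of positive odd integers, the odd-even graph $\mathcal{G}_A(O)$ is the simple undirected graph with vertex set $A$ in which distinct $a,b\in A$ are adjacent iff both $\frac{a+b}{2}$ and $\frac{|a-b|}{2}$ belong to $O$. -}

module Defs where

open import Data.Nat using (ℕ; _+_; _*_; _/_; ∣_-_∣; _≟_)
open import Data.Nat.Base using (NonZero)
open import Data.Bool using (Bool; true)
open import Data.List using (List; map; upTo; concatMap; filterᵇ; deduplicate; length; _∷_; [])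
open import Data.Fin using (Fin; toℕ)
open import Data.Product using (_×_; ∃)
open import Relation.Binary.PropositionalEquality using (_≡_; _≢_)
open import Relation.Binary.Construct.Closure.ReflexiveTransitive using (Star)

IsPositiveOddSet : (ℕ → Bool) → Set
IsPositiveOddSet O = ∀ n → O n ≡ true → ∃ λ k → n ≡ 2 * k + 1

evenSet : ℕ → List ℕ
evenSet m = map (λ i → 2 * i) (upTo m)

relValues : ℕ → List ℕ
relValues m = concatMap (λ a → concatMap (λ b → ((a + b) / 2) ∷ (∣ a - b ∣ / 2) ∷ []) (evenSet m)) (evenSet m)

ORel : (ℕ → Bool) → ℕ → List ℕ
ORel O m = deduplicate _≟_ (filterᵇ O (relValues m))

vertexValue : {m : ℕ} → Fin m → ℕ
vertexValue i = 2 * toℕ i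

Adj : (O : ℕ → Bool) → (m : ℕ) → Fin m → Fin m → Set
Adj O m i j =
  (vertexValue i ≢ vertexValue j)
  × (O ((vertexValue i + vertexValue j) / 2) ≡ true)
  × (O (∣ vertexValue i - vertexValue j ∣ / 2) ≡ true)

Connected : (O : ℕ → Bool) → (m : ℕ) → Set
Connected O m = (i j : Fin m) → Star (Adj O m) i j

-- Halve the vertices: x ≤ M stands for 2x, and x, y are adjacent iff x + y and |x − y| lie in O.
-- Call an odd e < 2M missing if e ∉ O; the density hypothesis says that the number r of missing
-- values satisfies 4r + 4 ≤ M. A vertex H fails to be adjacent to an x with H + x odd only if
-- H − x or H + x is missing, and these values are distinct for distinct x, so among the x < v
-- it fails at most as often as there are missing values in a window around H. Every vertex v has
-- about M/2 such partners, so v and a vertex H of the same parity share a neighbour below v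
-- as soon as their two windows hold at most 2r + 1 missing values. Taking M and M − 1 as hubs,
-- this first joins the two hubs, and then, descending from M − 2, joins every vertex either to
-- a larger neighbour or, through a common neighbour, to the hub of its own parity.

module Submission where

open import Defs
open import Data.Nat using (ℕ; _*_; _<_; _≤_)
open import Data.Bool using (Bool)
open import Data.List using (length)

open import Data.Nat using (zero; suc; _+_; _∸_; _/_; ∣_-_∣; z≤n; s≤s; z<s; _≟_; _<?_)
open import Data.Nat.DivMod using (m*n/n≡m)
open import Data.Nat.Properties
open import Data.Nat using (anyUpTo?)
open import Data.Nat.Tactic.RingSolver using (solve-∀)
open import Data.Bool using (true; false; not; _∧_; _xor_; if_then_else_)
open import Data.Bool.Properties using (not-distribˡ-xor; xor-same; xor-identityʳ; ∧-idem; ∧-conicalˡ; ∧-conicalʳ; ∧-identityʳ; ¬-not)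
import Data.Bool.Properties as Bool
open import Data.List using (List; []; _∷_; map; concat; upTo; filterᵇ)
open import Data.List.Properties using (length-map; length-upTo)
open import Data.List.Relation.Unary.All as All using (All; []; _∷_)
open import Data.List.Relation.Unary.All.Properties using (map⁺; concat⁺; applyUpTo⁺₁; filter⁺; all-filter; deduplicate⁺)
open import Data.List.Relation.Unary.Unique.DecPropositional.Properties using (deduplicate-!)
open import Data.Fin using (Fin; toℕ; fromℕ; fromℕ<)
open import Data.Fin.Properties using (toℕ-fromℕ; toℕ-fromℕ<; toℕ-injective; toℕ<n)
open import Data.List.Relation.Unary.AllPairs using ([]; _∷_)
open import Data.List.Relation.Unary.Unique.Propositional using (Unique)
open import Data.Product using (_×_; _,_; ∃-syntax; proj₁; proj₂)
open import Data.Sum using (_⊎_; inj₁; inj₂)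
open import Data.Empty using (⊥; ⊥-elim)
open import Function using (_∘_; id)
open import Function.Bundles using (Equivalence)
open import Relation.Binary.PropositionalEquality
open import Relation.Binary.Construct.Closure.ReflexiveTransitive using (Star; ε; _◅_; _◅◅_; reverse)
open import Relation.Nullary using (does; yes; no)
open import Relation.Nullary.Decidable using (_×-dec_; T?)
open import Relation.Nullary.Decidable using (dec-true; dec-false)

sumBelow : (ℕ → ℕ) → ℕ → ℕ
sumBelow f zero    = 0
sumBelow f (suc N) = sumBelow f N + f N

𝟙 : Bool → ℕ
𝟙 true  = 1
𝟙 false = 0

count : (ℕ → Bool) → ℕ → ℕ
count p = sumBelow (𝟙 ∘ p)

sumBelow-mono-≤ : ∀ {f g : ℕ → ℕ} N → (∀ t → t < N → f t ≤ g t) → sumBelow f N ≤ sumBelow g N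
sumBelow-mono-≤ zero    f≤g = z≤n
sumBelow-mono-≤ (suc N) f≤g =
  +-mono-≤ (sumBelow-mono-≤ N (λ t t<N → f≤g t (m<n⇒m<1+n t<N))) (f≤g N ≤-refl)

sumBelow-cong : ∀ {f g : ℕ → ℕ} N → (∀ t → f t ≡ g t) → sumBelow f N ≡ sumBelow g N
sumBelow-cong zero    f≗g = refl
sumBelow-cong (suc N) f≗g = cong₂ _+_ (sumBelow-cong N f≗g) (f≗g N)

sumBelow-+ : ∀ (f g : ℕ → ℕ) N → sumBelow (λ t → f t + g t) N ≡ sumBelow f N + sumBelow g N
sumBelow-+ f g zero    = refl
sumBelow-+ f g (suc N) = begin
  sumBelow (λ t → f t + g t) N + (f N + g N)   ≡⟨ cong (_+ (f N + g N)) (sumBelow-+ f g N) ⟩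
  sumBelow f N + sumBelow g N + (f N + g N)    ≡⟨ interchange (sumBelow f N) (sumBelow g N) (f N) (g N) ⟩
  sumBelow f N + f N + (sumBelow g N + g N)    ∎
  where
  open ≡-Reasoning
  interchange : ∀ a b c d → a + b + (c + d) ≡ a + c + (b + d)
  interchange = solve-∀

sumBelow-split : ∀ (f : ℕ → ℕ) a k → sumBelow f a + sumBelow (λ t → f (a + t)) k ≡ sumBelow f (a + k)
sumBelow-split f a zero    = trans (+-identityʳ _) (cong (sumBelow f) (sym (+-identityʳ a)))
sumBelow-split f a (suc k) = begin
  sumBelow f a + (sumBelow (λ t → f (a + t)) k + f (a + k))  ≡⟨ +-assoc (sumBelow f a) _ _ ⟨
  sumBelow f a + sumBelow (λ t → f (a + t)) k + f (a + k)    ≡⟨ cong (_+ f (a + k)) (sumBelow-split f a k) ⟩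
  sumBelow f (suc (a + k))                                     ≡⟨ cong (sumBelow f) (+-suc a k) ⟨
  sumBelow f (a + suc k)                                       ∎
  where open ≡-Reasoning

sumBelow-monoʳ-≤ : ∀ (f : ℕ → ℕ) {N K} → N ≤ K → sumBelow f N ≤ sumBelow f K
sumBelow-monoʳ-≤ f {N} {K} N≤K = begin
  sumBelow f N                                                ≤⟨ m≤m+n _ _ ⟩
  sumBelow f N + sumBelow (λ t → f (N + t)) (K ∸ N)           ≡⟨ sumBelow-split f N (K ∸ N) ⟩
  sumBelow f (N + (K ∸ N))                                    ≡⟨ cong (sumBelow f) (m+[n∸m]≡n N≤K) ⟩
  sumBelow f K                                                ∎
  where open ≤-Reasoning

count-witness : ∀ (p : ℕ → Bool) N → 0 < count p N → ∃[ t ] t < N × p t ≡ true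
count-witness p (suc N) 0<count with p N in pN
... | true  = N , ≤-refl , pN
... | false with count-witness p N (subst (0 <_) (+-identityʳ _) 0<count)
...   | t , t<N , pt = t , m<n⇒m<1+n t<N , pt

count-positive : ∀ (p : ℕ → Bool) {t N} → t < N → p t ≡ true → 1 ≤ count p N
count-positive p {t} {suc N} t<1+N pt with m<1+n⇒m<n∨m≡n t<1+N
... | inj₁ t<N  = ≤-trans (count-positive p t<N pt) (m≤m+n _ _)
... | inj₂ refl = ≤-trans (≤-reflexive (cong 𝟙 (sym pt))) (m≤n+m _ _)

count-unique : ∀ (p : ℕ → Bool) N {xs : List ℕ} →
               Unique xs → All (λ e → e < N × p e ≡ true) xs → length xs ≤ count p N
count-unique p N [] [] = z≤n
count-unique p N {x ∷ xs} (x∉xs ∷ xs-unique) ((x<N , px) ∷ xs-valid) = begin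
  suc (length xs)                               ≤⟨ s≤s (count-unique p-x N xs-unique (validWithout x∉xs xs-valid)) ⟩
  suc (count p-x N)                             ≡⟨ +-comm 1 _ ⟩
  count p-x N + 1                               ≤⟨ +-monoʳ-≤ (count p-x N) (count-positive p=x x<N p=x-x) ⟩
  count p-x N + count p=x N                     ≡⟨ sumBelow-+ (𝟙 ∘ p-x) (𝟙 ∘ p=x) N ⟨
  sumBelow (λ t → 𝟙 (p-x t) + 𝟙 (p=x t)) N      ≡⟨ sumBelow-cong N (λ t → 𝟙-split (p t) (does (t ≟ x))) ⟩
  count p N                                     ∎
  where
  open ≤-Reasoning
  p-x p=x : ℕ → Bool
  p-x t = p t ∧ not (does (t ≟ x))
  p=x t = p t ∧ does (t ≟ x)
  p=x-x : p=x x ≡ true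
  p=x-x = cong₂ _∧_ px (dec-true (x ≟ x) refl)
  𝟙-split : ∀ b c → 𝟙 (b ∧ not c) + 𝟙 (b ∧ c) ≡ 𝟙 b
  𝟙-split false c     = refl
  𝟙-split true  true  = refl
  𝟙-split true  false = refl
  validWithout : ∀ {ys} → All (x ≢_) ys → All (λ e → e < N × p e ≡ true) ys → All (λ e → e < N × p-x e ≡ true) ys
  validWithout []           []                  = []
  validWithout (x≢y ∷ x≢ys) ((y<N , py) ∷ ys-valid) =
    (y<N , cong₂ (λ a b → a ∧ not b) py (dec-false (_ ≟ x) (x≢y ∘ sym))) ∷ validWithout x≢ys ys-valid

odd? : ℕ → Bool
odd? zero    = false
odd? (suc n) = not (odd? n)

odd?-+ : ∀ m n → odd? (m + n) ≡ odd? m xor odd? n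
odd?-+ zero    n = refl
odd?-+ (suc m) n = trans (cong not (odd?-+ m n)) (not-distribˡ-xor (odd? m) (odd? n))

odd?-double : ∀ n → odd? (n + n) ≡ false
odd?-double n = trans (odd?-+ n n) (xor-same (odd? n))

odd?-+-even : ∀ m {n} → odd? n ≡ false → odd? (m + n) ≡ odd? m
odd?-+-even m {n} n-even = trans (odd?-+ m n) (trans (cong (odd? m xor_) n-even) (xor-identityʳ (odd? m)))

odd?-∸ : ∀ {m n} → n ≤ m → odd? (m ∸ n) ≡ odd? (m + n)
odd?-∸ {m} {n} n≤m = begin
  odd? (m ∸ n)                ≡⟨ odd?-+-even (m ∸ n) (odd?-double n) ⟨
  odd? (m ∸ n + (n + n))      ≡⟨ cong odd? (+-assoc (m ∸ n) n n) ⟨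
  odd? (m ∸ n + n + n)        ≡⟨ cong (λ k → odd? (k + n)) (m∸n+n≡m n≤m) ⟩
  odd? (m + n)                ∎
  where open ≡-Reasoning

odd?-+-cong : ∀ a b x → odd? (a + b) ≡ false → odd? (a + x) ≡ odd? (b + x)
odd?-+-cong a b x a+b-even rewrite odd?-+ a x | odd?-+ b x
  = cong (_xor odd? x) (xor≡false⇒≡ (odd? a) (odd? b) (trans (sym (odd?-+ a b)) a+b-even))
  where
  xor≡false⇒≡ : ∀ p q → p xor q ≡ false → p ≡ q
  xor≡false⇒≡ true  true  _ = refl
  xor≡false⇒≡ false false _ = refl

oddPartnersBelow : ℕ → ℕ → ℕ
oddPartnersBelow v = count (λ x → odd? (v + x))

oddPartnersBelow-lower : ∀ v N → N ≤ 2 * oddPartnersBelow v N + 1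
oddPartnersBelow-lower v zero          = z≤n
oddPartnersBelow-lower v (suc zero)    = m≤n+m 1 _
oddPartnersBelow-lower v (suc (suc N)) = begin
  suc (suc N)                ≤⟨ s≤s (s≤s (oddPartnersBelow-lower v N)) ⟩
  2 + (2 * c + 1)            ≡⟨ rearrange c ⟩
  2 * (c + 1) + 1            ≡⟨ cong (λ k → 2 * k + 1) (trans (+-assoc c _ _) (cong (c +_) consecutive)) ⟨
  2 * oddPartnersBelow v (suc (suc N)) + 1 ∎
  where
  open ≤-Reasoning
  c = oddPartnersBelow v N
  rearrange : ∀ c → 2 + (2 * c + 1) ≡ 2 * (c + 1) + 1
  rearrange = solve-∀
  𝟙-not : ∀ b → 𝟙 b + 𝟙 (not b) ≡ 1
  𝟙-not true  = refl
  𝟙-not false = refl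
  consecutive : 𝟙 (odd? (v + N)) + 𝟙 (odd? (v + suc N)) ≡ 1
  consecutive rewrite +-suc v N = 𝟙-not (odd? (v + N))

oddPartnersBelow-≥ : ∀ v k {N} → 2 * k + 1 ≤ N → k ≤ oddPartnersBelow v N
oddPartnersBelow-≥ v k 2k+1≤N =
  *-cancelˡ-≤ 2 (+-cancelʳ-≤ 1 _ _ (≤-trans 2k+1≤N (oddPartnersBelow-lower v _)))

cancel-excess : ∀ {L E R T P} → L + E ≤ R → R < T → T ≤ P + E → L < P
cancel-excess {E = E} L+E≤R R<T T≤P+E = +-cancelʳ-< E _ _ (≤-<-trans L+E≤R (<-≤-trans R<T T≤P+E))

module Graph (O : ℕ → Bool) where

  -- Vertex x stands for the even number 2x, so adj x y says that 2x and 2y are adjacent in 𝒢_A(O).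
  adj : ℕ → ℕ → Bool
  adj x y = O (x + y) ∧ O ∣ x - y ∣

  adj-sym : ∀ x y → adj x y ≡ adj y x
  adj-sym x y = cong₂ (λ s d → O s ∧ O d) (+-comm x y) (∣-∣-comm x y)

  missing : ℕ → Bool
  missing e = odd? e ∧ not (O e)

  missingBelow : ℕ → ℕ
  missingBelow = count missing

  nonNeighbour : ℕ → ℕ → Bool
  nonNeighbour H x = odd? (H + x) ∧ not (adj H x)

  nonNeighboursBelow : ℕ → ℕ → ℕ
  nonNeighboursBelow H = count (nonNeighbour H)

  nonNeighbour-0 : ∀ H → nonNeighbour H 0 ≡ missing H
  nonNeighbour-0 H rewrite +-identityʳ H | ∣-∣-identityʳ H | ∧-idem (O H) = refl

  nonNeighbour≤missing : ∀ {H x} → x ≤ H → 𝟙 (nonNeighbour H x) ≤ 𝟙 (missing (H ∸ x)) + 𝟙 (missing (H + x))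
  nonNeighbour≤missing {H} {x} x≤H rewrite m≤n⇒∣n-m∣≡n∸m x≤H | odd?-∸ x≤H =
    𝟙-∧-not-∧ (odd? (H + x)) (O (H + x)) (O (H ∸ x))
    where
    𝟙-∧-not-∧ : ∀ p q r → 𝟙 (p ∧ not (q ∧ r)) ≤ 𝟙 (p ∧ not r) + 𝟙 (p ∧ not q)
    𝟙-∧-not-∧ false q     r     = z≤n
    𝟙-∧-not-∧ true  true  true  = z≤n
    𝟙-∧-not-∧ true  true  false = s≤s z≤n
    𝟙-∧-not-∧ true  false r     = m≤n+m 1 _

  nonNeighbour-of-nonAdj : ∀ H v u → odd? (H + v) ≡ false → adj H u ≡ false → nonNeighbour H u ≡ odd? (v + u)
  nonNeighbour-of-nonAdj H v u H+v-even H≁u =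
    trans (cong₂ (λ p a → p ∧ not a) (odd?-+-cong H v u H+v-even) H≁u) (∧-identityʳ _)

  nonAdjacentPartner-missing : ∀ w t → adj w (w + t) ≡ false →
    𝟙 (odd? (w + (w + t))) ≤ 𝟙 (missing t) + 𝟙 (missing (w + t + w))
  nonAdjacentPartner-missing w t w≁u = begin
    𝟙 (odd? (w + (w + t)))                             ≡⟨ cong 𝟙 u-nonNeighbour ⟨
    𝟙 (nonNeighbour (w + t) w)                         ≤⟨ nonNeighbour≤missing (m≤m+n w t) ⟩
    𝟙 (missing (w + t ∸ w)) + 𝟙 (missing (w + t + w))  ≡⟨ cong (λ e → 𝟙 (missing e) + 𝟙 (missing (w + t + w))) (m+n∸m≡n w t) ⟩
    𝟙 (missing t) + 𝟙 (missing (w + t + w))           ∎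
    where
    open ≤-Reasoning
    u-nonNeighbour : nonNeighbour (w + t) w ≡ odd? (w + (w + t))
    u-nonNeighbour = trans (cong₂ (λ p a → p ∧ not a) (cong odd? (+-comm (w + t) w)) (trans (adj-sym (w + t) w) w≁u))
                           (∧-identityʳ _)

  -- The values H ± x for x ≤ b lie in the window [H − b, H + b], and different x give different values.
  nonNeighboursBelow-window : ∀ {H} b → b ≤ H →
    nonNeighboursBelow H (suc b) + missingBelow (H ∸ b) ≤ missingBelow (suc (H + b))
  nonNeighboursBelow-window {H} zero _ rewrite nonNeighbour-0 H | +-identityʳ H =
    ≤-reflexive (+-comm (𝟙 (missing H)) _)
  nonNeighboursBelow-window {H} (suc b) 1+b≤H = begin
    nonNeighboursBelow H (suc b) + 𝟙 (nonNeighbour H (suc b)) + missingBelow d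
      ≤⟨ +-monoˡ-≤ (missingBelow d) (+-monoʳ-≤ (nonNeighboursBelow H (suc b)) (nonNeighbour≤missing 1+b≤H)) ⟩
    nonNeighboursBelow H (suc b) + (𝟙 (missing d) + 𝟙 (missing (H + suc b))) + missingBelow d
      ≡⟨ rearrange (nonNeighboursBelow H (suc b)) (𝟙 (missing d)) _ (missingBelow d) ⟩
    nonNeighboursBelow H (suc b) + missingBelow (suc d) + 𝟙 (missing (H + suc b))
      ≡⟨ cong (λ k → nonNeighboursBelow H (suc b) + missingBelow k + 𝟙 (missing (H + suc b))) (+-∸-assoc 1 1+b≤H) ⟨
    nonNeighboursBelow H (suc b) + missingBelow (H ∸ b) + 𝟙 (missing (H + suc b))
      ≤⟨ +-monoˡ-≤ _ (nonNeighboursBelow-window b (<⇒≤ 1+b≤H)) ⟩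
    missingBelow (suc (H + b)) + 𝟙 (missing (H + suc b))
      ≡⟨ cong (λ k → missingBelow k + 𝟙 (missing (H + suc b))) (+-suc H b) ⟨
    missingBelow (suc (H + suc b)) ∎
    where
    open ≤-Reasoning
    d = H ∸ suc b
    rearrange : ∀ a x y z → a + (x + y) + z ≡ a + (z + x) + y
    rearrange = solve-∀

  nonNeighboursBelow-bound : ∀ {H} v → v ≤ H → nonNeighboursBelow H v + missingBelow (H ∸ v) ≤ missingBelow (H + v)
  nonNeighboursBelow-bound {H} zero    _     = ≤-reflexive (cong missingBelow (sym (+-identityʳ H)))
  nonNeighboursBelow-bound {H} (suc b) 1+b≤H = begin
    nonNeighboursBelow H (suc b) + missingBelow (H ∸ suc b)  ≤⟨ +-monoʳ-≤ _ (sumBelow-monoʳ-≤ _ (∸-monoʳ-≤ H (n≤1+n b))) ⟩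
    nonNeighboursBelow H (suc b) + missingBelow (H ∸ b)      ≤⟨ nonNeighboursBelow-window b (<⇒≤ 1+b≤H) ⟩
    missingBelow (suc (H + b))                               ≡⟨ cong missingBelow (+-suc H b) ⟨
    missingBelow (H + suc b)                                 ∎
    where open ≤-Reasoning

  missingBelow-past-even : ∀ {h} → odd? h ≡ false → missingBelow (2 + h) ≤ missingBelow h + 1
  missingBelow-past-even {h} h-even rewrite h-even | +-identityʳ (missingBelow h) =
    +-monoʳ-≤ (missingBelow h) (𝟙≤1 (not (O (suc h))))
    where
    𝟙≤1 : ∀ b → 𝟙 b ≤ 1
    𝟙≤1 true  = ≤-refl
    𝟙≤1 false = z≤n

  CommonBelow : ℕ → ℕ → Set
  CommonBelow v H = ∃[ x ] x < v × adj v x ≡ true × adj H x ≡ true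

  commonBelow-count : ∀ {v H} → odd? (H + v) ≡ false →
    nonNeighboursBelow v v + nonNeighboursBelow H v < oddPartnersBelow v v → CommonBelow v H
  commonBelow-count {v} {H} H+v-even losses<partners
    with count-witness common v (+-cancelʳ-< losses 0 _ (<-≤-trans losses<partners partners≤))
    where
    common : ℕ → Bool
    common x = adj v x ∧ adj H x
    losses = nonNeighboursBelow v v + nonNeighboursBelow H v
    partner-lost-or-common : ∀ x → 𝟙 (odd? (v + x)) ≤ 𝟙 (common x) + (𝟙 (nonNeighbour v x) + 𝟙 (nonNeighbour H x))
    partner-lost-or-common x = 𝟙-split (adj v x) (adj H x) (odd?-+-cong H v x H+v-even)
      where
      𝟙-split : ∀ {p q} a c → q ≡ p → 𝟙 p ≤ 𝟙 (a ∧ c) + (𝟙 (p ∧ not a) + 𝟙 (q ∧ not c))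
      𝟙-split {false} a     c     refl = z≤n
      𝟙-split {true}  true  true  refl = s≤s z≤n
      𝟙-split {true}  true  false refl = s≤s z≤n
      𝟙-split {true}  false c     refl = s≤s z≤n
    partners≤ : oddPartnersBelow v v ≤ count common v + losses
    partners≤ = ≤-trans (sumBelow-mono-≤ v (λ x _ → partner-lost-or-common x))
                  (≤-reflexive (trans (sumBelow-+ _ _ v) (cong (count common v +_) (sumBelow-+ _ _ v))))
  ... | x , x<v , common-x = x , x<v , ∧-conicalˡ (adj v x) (adj H x) common-x , ∧-conicalʳ (adj v x) (adj H x) common-x

module Connectivity (O : ℕ → Bool) (n : ℕ)
  (few-missing : 4 * Graph.missingBelow O (suc (suc n) + suc (suc n)) + 4 ≤ suc (suc n)) where

  open Graph O

  M′ M : ℕ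
  M′ = suc n
  M  = suc M′

  ≤n⇒≤M : ∀ {v} → v ≤ n → v ≤ M
  ≤n⇒≤M v≤n = m≤n⇒m≤1+n (m≤n⇒m≤1+n v≤n)

  totalMissing : ℕ
  totalMissing = missingBelow (M + M)

  missingBelow≤total : ∀ {a} → a ≤ M + M → missingBelow a ≤ totalMissing
  missingBelow≤total = sumBelow-monoʳ-≤ _

  nonNeighboursBelow≤total : ∀ {v H} → v ≤ H → H ≤ M → nonNeighboursBelow H v ≤ totalMissing
  nonNeighboursBelow≤total {v} {H} v≤H H≤M = begin
    nonNeighboursBelow H v                           ≤⟨ m≤m+n _ _ ⟩
    nonNeighboursBelow H v + missingBelow (H ∸ v)    ≤⟨ nonNeighboursBelow-bound v v≤H ⟩
    missingBelow (H + v)                             ≤⟨ missingBelow≤total (+-mono-≤ H≤M (≤-trans v≤H H≤M)) ⟩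
    totalMissing                                     ∎
    where open ≤-Reasoning

  enough-below-M′ : 2 * suc (totalMissing + totalMissing) + 1 ≤ M′
  enough-below-M′ = ≤-pred (subst (_≤ M) (arith totalMissing) few-missing)
    where
    arith : ∀ r → 4 * r + 4 ≡ suc (2 * suc (r + r) + 1)
    arith = solve-∀

  enough-up-to-M : 2 * suc (totalMissing + suc totalMissing) + 1 ≤ suc M
  enough-up-to-M = subst (_≤ suc M) (arith totalMissing) (s≤s few-missing)
    where
    arith : ∀ r → suc (4 * r + 4) ≡ 2 * suc (r + suc r) + 1
    arith = solve-∀

  commonBelow-hub : ∀ {v H} → v ≤ n → M′ ≤ H → H ≤ M → odd? (H + v) ≡ false →
    (∀ u → v < u → u ≤ n → odd? (v + u) ≡ true → adj H u ≡ false) → CommonBelow v H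
  commonBelow-hub {v} {H} v≤n M′≤H H≤M H+v-even H-misses =
    commonBelow-count H+v-even (cancel-excess losses≤ (≤-refl {suc (totalMissing + totalMissing)}) partners≥)
    where
    open ≤-Reasoning
    j = M′ ∸ v
    v+j≡M′ : v + j ≡ M′
    v+j≡M′ = m+[n∸m]≡n (m≤n⇒m≤1+n v≤n)
    lostAbove = sumBelow (λ t → 𝟙 (nonNeighbour H (v + t))) j
    partnerAbove-lost : ∀ t → t < j → 𝟙 (odd? (v + (v + t))) ≤ 𝟙 (nonNeighbour H (v + t))
    partnerAbove-lost zero _ rewrite +-identityʳ v | odd?-double v = z≤n
    partnerAbove-lost (suc s) 1+s<j with odd? (v + (v + suc s)) in v+u-odd
    ... | false = z≤n
    ... | true  = ≤-reflexive (cong 𝟙 (sym (trans (nonNeighbour-of-nonAdj H v (v + suc s) H+v-even H≁u) v+u-odd)))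
      where
      H≁u : adj H (v + suc s) ≡ false
      H≁u = H-misses (v + suc s) (m<m+n v z<s) (≤-pred (subst (v + suc s <_) v+j≡M′ (+-monoʳ-< v 1+s<j))) v+u-odd
    losses≤ : nonNeighboursBelow v v + nonNeighboursBelow H v + lostAbove ≤ totalMissing + totalMissing
    losses≤ = begin
      nonNeighboursBelow v v + nonNeighboursBelow H v + lostAbove
        ≡⟨ +-assoc (nonNeighboursBelow v v) _ _ ⟩
      nonNeighboursBelow v v + (nonNeighboursBelow H v + lostAbove)
        ≡⟨ cong (nonNeighboursBelow v v +_) (trans (sumBelow-split _ v j) (cong (nonNeighboursBelow H) v+j≡M′)) ⟩
      nonNeighboursBelow v v + nonNeighboursBelow H M′
        ≤⟨ +-mono-≤ (nonNeighboursBelow≤total ≤-refl (≤n⇒≤M v≤n))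
                    (nonNeighboursBelow≤total M′≤H H≤M) ⟩
      totalMissing + totalMissing ∎
    partners≥ : suc (totalMissing + totalMissing) ≤ oddPartnersBelow v v + lostAbove
    partners≥ = begin
      suc (totalMissing + totalMissing)
        ≤⟨ oddPartnersBelow-≥ v _ enough-below-M′ ⟩
      oddPartnersBelow v M′
        ≡⟨ cong (oddPartnersBelow v) v+j≡M′ ⟨
      oddPartnersBelow v (v + j)
        ≡⟨ sumBelow-split _ v j ⟨
      oddPartnersBelow v v + sumBelow (λ t → 𝟙 (odd? (v + (v + t)))) j
        ≤⟨ +-monoʳ-≤ (oddPartnersBelow v v) (sumBelow-mono-≤ j partnerAbove-lost) ⟩
      oddPartnersBelow v v + lostAbove ∎

  highMissing : ℕ → ℕ
  highMissing w = sumBelow (λ s → 𝟙 (missing (w + suc w + s))) (M ∸ w)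

  lowLosses-bound : ∀ {w H} → w ≤ H → M′ ≤ H → H ≤ M → odd? (H + w) ≡ false →
    nonNeighboursBelow H w + missingBelow (suc (M ∸ w)) ≤ suc totalMissing
  lowLosses-bound {w} {H} w≤H M′≤H H≤M H+w-even = begin
    nonNeighboursBelow H w + missingBelow (suc (M ∸ w))  ≤⟨ +-monoʳ-≤ (nonNeighboursBelow H w) (sumBelow-monoʳ-≤ (𝟙 ∘ missing) (s≤s M-w≤1+h)) ⟩
    nonNeighboursBelow H w + missingBelow (2 + h)        ≤⟨ +-monoʳ-≤ (nonNeighboursBelow H w) (missingBelow-past-even {h} h-even) ⟩
    nonNeighboursBelow H w + (missingBelow h + 1)        ≡⟨ +-assoc _ (missingBelow h) 1 ⟨
    nonNeighboursBelow H w + missingBelow h + 1          ≤⟨ +-monoˡ-≤ 1 (nonNeighboursBelow-bound w w≤H) ⟩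
    missingBelow (H + w) + 1                             ≤⟨ +-monoˡ-≤ 1 (missingBelow≤total (+-mono-≤ H≤M (≤-trans w≤H H≤M))) ⟩
    totalMissing + 1                                     ≡⟨ +-comm totalMissing 1 ⟩
    suc totalMissing                                     ∎
    where
    open ≤-Reasoning
    h = H ∸ w
    h-even : odd? h ≡ false
    h-even = trans (odd?-∸ w≤H) H+w-even
    M-w≤1+h : M ∸ w ≤ suc h
    M-w≤1+h = ≤-trans (∸-monoˡ-≤ w (s≤s M′≤H)) (≤-reflexive (+-∸-assoc 1 w≤H))

  highLosses-bound : ∀ {w} → w < M → nonNeighboursBelow w w + highMissing w ≤ totalMissing
  highLosses-bound {w} w<M = begin
    nonNeighboursBelow w w + highMissing w      ≤⟨ +-monoˡ-≤ (highMissing w) (≤-trans (m≤m+n _ _) (nonNeighboursBelow-bound w ≤-refl)) ⟩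
    missingBelow (w + w) + highMissing w        ≤⟨ +-monoˡ-≤ (highMissing w) (sumBelow-monoʳ-≤ _ (+-monoʳ-≤ w (n≤1+n w))) ⟩
    missingBelow (w + suc w) + highMissing w    ≡⟨ sumBelow-split _ (w + suc w) (M ∸ w) ⟩
    missingBelow (w + suc w + (M ∸ w))          ≤⟨ missingBelow≤total (≤-trans (≤-reflexive (arith w (M ∸ w))) 2w+1+[M-w]≤M+M) ⟩
    totalMissing                                ∎
    where
    open ≤-Reasoning
    arith : ∀ w k → w + suc w + k ≡ suc w + (w + k)
    arith = solve-∀
    2w+1+[M-w]≤M+M : suc w + (w + (M ∸ w)) ≤ M + M
    2w+1+[M-w]≤M+M = subst (λ m → suc w + m ≤ M + M) (sym (m+[n∸m]≡n (<⇒≤ w<M))) (+-monoˡ-≤ M w<M)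

  commonBelow-stuck : ∀ {w H} → w ≤ n → M′ ≤ H → H ≤ M → odd? (H + w) ≡ false →
    (∀ u → w < u → u ≤ M → adj w u ≡ false) → CommonBelow w H
  commonBelow-stuck {w} {H} w≤n M′≤H H≤M H+w-even w-stuck =
    commonBelow-count H+w-even (cancel-excess losses≤ (≤-refl {suc (totalMissing + suc totalMissing)}) partners≥)
    where
    open ≤-Reasoning
    k = M ∸ w
    w<M : w < M
    w<M = s≤s (m≤n⇒m≤1+n w≤n)
    w+k≡M : w + k ≡ M
    w+k≡M = m+[n∸m]≡n (<⇒≤ w<M)
    lostTo : ℕ → ℕ
    lostTo zero    = 0
    lostTo (suc s) = 𝟙 (missing (suc s)) + 𝟙 (missing (w + suc w + s))
    partnerAbove-lost : ∀ t → t < suc k → 𝟙 (odd? (w + (w + t))) ≤ lostTo t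
    partnerAbove-lost zero    _ rewrite +-identityʳ w | odd?-double w = z≤n
    partnerAbove-lost (suc s) 1+s<1+k =
      subst (λ e → 𝟙 (odd? (w + (w + suc s))) ≤ 𝟙 (missing (suc s)) + 𝟙 (missing e)) (arith w s)
        (nonAdjacentPartner-missing w (suc s) (w-stuck (w + suc s) (m<m+n w z<s) u≤M))
      where
      arith : ∀ w s → w + suc s + w ≡ w + suc w + s
      arith = solve-∀
      u≤M : w + suc s ≤ M
      u≤M = subst (w + suc s ≤_) w+k≡M (+-monoʳ-≤ w (≤-pred 1+s<1+k))
    losses≤ : nonNeighboursBelow w w + nonNeighboursBelow H w + (missingBelow (suc k) + highMissing w)
              ≤ totalMissing + suc totalMissing
    losses≤ = begin
      nonNeighboursBelow w w + nonNeighboursBelow H w + (missingBelow (suc k) + highMissing w)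
        ≡⟨ rearrange (nonNeighboursBelow w w) (nonNeighboursBelow H w) (missingBelow (suc k)) (highMissing w) ⟩
      (nonNeighboursBelow w w + highMissing w) + (nonNeighboursBelow H w + missingBelow (suc k))
        ≤⟨ +-mono-≤ (highLosses-bound w<M) (lowLosses-bound (≤-trans (m≤n⇒m≤1+n w≤n) M′≤H) M′≤H H≤M H+w-even) ⟩
      totalMissing + suc totalMissing ∎
      where
      rearrange : ∀ a b c d → a + b + (c + d) ≡ (a + d) + (b + c)
      rearrange = solve-∀
    partners≥ : suc (totalMissing + suc totalMissing) ≤ oddPartnersBelow w w + (missingBelow (suc k) + highMissing w)
    partners≥ = begin
      suc (totalMissing + suc totalMissing)
        ≤⟨ oddPartnersBelow-≥ w _ enough-up-to-M ⟩
      oddPartnersBelow w (suc M)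
        ≡⟨ cong (oddPartnersBelow w) (trans (+-suc w k) (cong suc w+k≡M)) ⟨
      oddPartnersBelow w (w + suc k)
        ≡⟨ sumBelow-split _ w (suc k) ⟨
      oddPartnersBelow w w + sumBelow (λ t → 𝟙 (odd? (w + (w + t)))) (suc k)
        ≤⟨ +-monoʳ-≤ (oddPartnersBelow w w) (sumBelow-mono-≤ (suc k) partnerAbove-lost) ⟩
      oddPartnersBelow w w + sumBelow lostTo (suc k)
        ≡⟨ cong (oddPartnersBelow w w +_) lostTo-split ⟨
      oddPartnersBelow w w + (missingBelow (suc k) + highMissing w) ∎
      where
      lostTo-split : missingBelow (suc k) + highMissing w ≡ sumBelow lostTo (suc k)
      lostTo-split = trans (cong (_+ highMissing w) (sym (sumBelow-split (𝟙 ∘ missing) 1 k)))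
                           (trans (sym (sumBelow-+ _ _ k)) (sumBelow-split lostTo 1 k))

  hub : Bool → ℕ
  hub b = if b xor odd? M′ then M else M′

  hub-parity : ∀ b → odd? (hub b) ≡ b
  hub-parity true  with odd? M′ in M′-parity
  ... | true  = M′-parity
  ... | false = cong not M′-parity
  hub-parity false with odd? M′ in M′-parity
  ... | true  = cong not M′-parity
  ... | false = M′-parity

  hub-cases : ∀ b → (hub b ≡ M × hub (not b) ≡ M′) ⊎ (hub b ≡ M′ × hub (not b) ≡ M)
  hub-cases true  with odd? M′
  ... | true  = inj₂ (refl , refl)
  ... | false = inj₁ (refl , refl)
  hub-cases false with odd? M′
  ... | true  = inj₁ (refl , refl)
  ... | false = inj₂ (refl , refl)

  M′≤hub : ∀ b → M′ ≤ hub b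
  M′≤hub b with hub-cases b
  ... | inj₁ (hub≡M , _)  = subst (M′ ≤_) (sym hub≡M) (n≤1+n M′)
  ... | inj₂ (hub≡M′ , _) = ≤-reflexive (sym hub≡M′)

  hub≤M : ∀ b → hub b ≤ M
  hub≤M b with hub-cases b
  ... | inj₁ (hub≡M , _)  = ≤-reflexive hub≡M
  ... | inj₂ (hub≡M′ , _) = subst (_≤ M) (sym hub≡M′) (n≤1+n M′)

  hubOf oppositeHub : ℕ → ℕ
  hubOf v       = hub (odd? v)
  oppositeHub v = hub (not (odd? v))

  hubOf-parity : ∀ v → odd? (hubOf v + v) ≡ false
  hubOf-parity v rewrite odd?-+ (hubOf v) v | hub-parity (odd? v) = xor-same (odd? v)

  oppositeHub-of-partner : ∀ v u → odd? (v + u) ≡ true → oppositeHub u ≡ hubOf v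
  oppositeHub-of-partner v u v+u-odd =
    cong hub (not-of-xor (odd? v) (odd? u) (trans (sym (odd?-+ v u)) v+u-odd))
    where
    not-of-xor : ∀ p q → p xor q ≡ true → not q ≡ p
    not-of-xor true  false _ = refl
    not-of-xor false true  _ = refl

  -- Linked x abstracts "x is joined to M by a walk", which keeps the argument on ℕ rather than Fin.
  module _ (Linked : ℕ → Set) (linked-M : Linked M)
           (linked-step : ∀ {x y} → x ≤ M → y ≤ M → adj x y ≡ true → Linked y → Linked x) where

    linked-M′-via : ∀ {v x a b} → (a ≡ M × b ≡ M′) ⊎ (a ≡ M′ × b ≡ M) → v ≤ M → x ≤ M →
      adj v b ≡ true → adj v x ≡ true → adj a x ≡ true → Linked M′
    linked-M′-via {v} {x} (inj₁ (refl , refl)) v≤M x≤M v~M′ v~x M~x =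
      linked-step (n≤1+n M′) v≤M (trans (adj-sym M′ v) v~M′)
        (linked-step v≤M x≤M v~x (linked-step x≤M ≤-refl (trans (adj-sym x M) M~x) linked-M))
    linked-M′-via {v} {x} (inj₂ (refl , refl)) v≤M x≤M v~M v~x M′~x =
      linked-step (n≤1+n M′) x≤M M′~x
        (linked-step x≤M v≤M (trans (adj-sym x v) v~x) (linked-step v≤M ≤-refl v~M linked-M))

    OppositeHubsMissedAbove : ℕ → Set
    OppositeHubsMissedAbove v = ∀ u → v < u → u ≤ n → adj u (oppositeHub u) ≡ false

    commonBelow-hubOf : ∀ {v} → v ≤ n → OppositeHubsMissedAbove v → CommonBelow v (hubOf v)
    commonBelow-hubOf {v} v≤n missed = commonBelow-hub v≤n (M′≤hub (odd? v)) (hub≤M (odd? v)) (hubOf-parity v)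
      λ u v<u u≤n v+u-odd → trans (adj-sym (hubOf v) u)
        (subst (λ h → adj u h ≡ false) (oppositeHub-of-partner v u v+u-odd) (missed u v<u u≤n))

    missedAbove-step : ∀ {v} → adj (suc v) (oppositeHub (suc v)) ≡ false →
      OppositeHubsMissedAbove (suc v) → OppositeHubsMissedAbove v
    missedAbove-step v~opposite missed u v<u u≤n with m≤n⇒m<n∨m≡n v<u
    ... | inj₁ 1+v<u = missed u 1+v<u u≤n
    ... | inj₂ refl  = v~opposite

    linked-M′-of-common : ∀ {v} → v ≤ n → adj v (oppositeHub v) ≡ true → CommonBelow v (hubOf v) → Linked M′
    linked-M′-of-common {v} v≤n v~opposite (x , x<v , v~x , hub~x) =
      linked-M′-via (hub-cases (odd? v)) (≤n⇒≤M v≤n) (≤n⇒≤M (<⇒≤ (<-≤-trans x<v v≤n))) v~opposite v~x hub~x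

    -- Descending from v = n, the first v adjacent to its opposite hub is joined to its own hub through
    -- a common neighbour below v; at v = 0 there is no room for that neighbour, so such a v is met.
    linked-M′-below : ∀ v → v ≤ n → OppositeHubsMissedAbove v → Linked M′
    linked-M′-below zero    0≤n missed = ⊥-elim (n≮0 (proj₁ (proj₂ (commonBelow-hubOf 0≤n missed))))
    linked-M′-below (suc v) 1+v≤n missed with adj (suc v) (oppositeHub (suc v)) in v~opposite
    ... | true  = linked-M′-of-common 1+v≤n v~opposite (commonBelow-hubOf 1+v≤n missed)
    ... | false = linked-M′-below v (<⇒≤ 1+v≤n) (missedAbove-step v~opposite missed)

    linked-M′ : Linked M′
    linked-M′ = linked-M′-below n ≤-refl (λ u n<u u≤n → ⊥-elim (<⇒≱ n<u u≤n))

    linked-hub : ∀ b → Linked (hub b)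
    linked-hub b with hub-cases b
    ... | inj₁ (hub≡M , _)  = subst Linked (sym hub≡M) linked-M
    ... | inj₂ (hub≡M′ , _) = subst Linked (sym hub≡M′) linked-M′

    LinkedFrom : ℕ → Set
    LinkedFrom x = ∀ {y} → x ≤ y → y ≤ M → Linked y

    linked-of-common : ∀ {x} → x ≤ M → CommonBelow x (hubOf x) → Linked x
    linked-of-common {x} x≤M (z , z<x , x~z , hub~z) =
      linked-step x≤M z≤M x~z (linked-step z≤M (hub≤M (odd? x)) (trans (adj-sym z (hubOf x)) hub~z) (linked-hub (odd? x)))
      where
      z≤M : z ≤ M
      z≤M = ≤-trans (<⇒≤ z<x) x≤M

    linked-low : ∀ {x} → x ≤ n → LinkedFrom (suc x) → Linked x
    linked-low {x} x≤n above with anyUpTo? (λ y → x <? y ×-dec adj x y Bool.≟ true) (suc M)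
    ... | yes (y , y<1+M , x<y , x~y) = linked-step (≤n⇒≤M x≤n) (≤-pred y<1+M) x~y (above x<y (≤-pred y<1+M))
    ... | no no-upper-neighbour = linked-of-common (≤n⇒≤M x≤n)
      (commonBelow-stuck x≤n (M′≤hub (odd? x)) (hub≤M (odd? x)) (hubOf-parity x)
        λ u x<u u≤M → ¬-not (λ x~u → no-upper-neighbour (u , s≤s u≤M , x<u , x~u)))

    linked-vertex : ∀ {x} → x ≤ M → LinkedFrom (suc x) → Linked x
    linked-vertex x≤M above with m≤n⇒m<n∨m≡n x≤M
    ... | inj₂ refl = linked-M
    ... | inj₁ x<M with m≤n⇒m<n∨m≡n (≤-pred x<M)
    ...   | inj₂ refl = linked-M′
    ...   | inj₁ x<M′ = linked-low (≤-pred x<M′) above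

    linkedFrom-step : ∀ {x} → LinkedFrom (suc x) → LinkedFrom x
    linkedFrom-step above x≤y y≤M with m≤n⇒m<n∨m≡n x≤y
    ... | inj₁ x<y  = above x<y y≤M
    ... | inj₂ refl = linked-vertex y≤M above

    linkedFrom : ∀ d {x} → x + d ≡ M → LinkedFrom x
    linkedFrom zero    {x} x+0≡M x≤y y≤M =
      subst Linked (≤-antisym (subst (_≤ _) (trans (sym (+-identityʳ x)) x+0≡M) x≤y) y≤M) linked-M
    linkedFrom (suc d) {x} x+1+d≡M = linkedFrom-step (linkedFrom d (trans (sym (+-suc x d)) x+1+d≡M))

    linked-all : ∀ {x} → x ≤ M → Linked x
    linked-all = linkedFrom M refl z≤n

odd?-2* : ∀ k → odd? (2 * k) ≡ false
odd?-2* k = subst (λ j → odd? (k + j) ≡ false) (sym (+-identityʳ k)) (odd?-double k)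

positiveOdd⇒odd : ∀ {O} → IsPositiveOddSet O → ∀ e → O e ≡ true → odd? e ≡ true
positiveOdd⇒odd O-positiveOdd e Oe with O-positiveOdd e Oe
... | k , refl = trans (odd?-+ (2 * k) 1) (cong (_xor true) (odd?-2* k))

half-sum : ∀ x y → (2 * x + 2 * y) / 2 ≡ x + y
half-sum x y rewrite sym (*-distribˡ-+ 2 x y) | *-comm 2 (x + y) = m*n/n≡m (x + y) 2

half-dist : ∀ x y → ∣ 2 * x - 2 * y ∣ / 2 ≡ ∣ x - y ∣
half-dist x y rewrite sym (*-distribˡ-∣-∣ 2 x y) | *-comm 2 ∣ x - y ∣ = m*n/n≡m ∣ x - y ∣ 2

module Vertices (O : ℕ → Bool) (O-odd : ∀ e → O e ≡ true → odd? e ≡ true) (m : ℕ) where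

  open Graph O

  adj-irreflexive : ∀ x → adj x x ≡ true → ⊥
  adj-irreflexive x x~x with trans (sym (O-odd (x + x) (∧-conicalˡ _ _ x~x))) (odd?-double x)
  ... | ()

  adj⇒Adj : ∀ {i j : Fin m} → adj (toℕ i) (toℕ j) ≡ true → Adj O m i j
  adj⇒Adj {i} {j} i~j =
    (λ 2i≡2j → adj-irreflexive (toℕ j) (subst (λ a → adj a (toℕ j) ≡ true) (*-cancelˡ-≡ (toℕ i) (toℕ j) 2 2i≡2j) i~j)) ,
    trans (cong O (half-sum (toℕ i) (toℕ j))) (∧-conicalˡ _ _ i~j) ,
    trans (cong O (half-dist (toℕ i) (toℕ j))) (∧-conicalʳ _ _ i~j)

  Adj-sym : ∀ i j → Adj O m i j → Adj O m j i
  Adj-sym i j (distinct , sum-in-O , dist-in-O) =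
    (distinct ∘ sym) ,
    subst (λ s → O (s / 2) ≡ true) (+-comm (vertexValue i) (vertexValue j)) sum-in-O ,
    subst (λ d → O (d / 2) ≡ true) (∣-∣-comm (vertexValue i) (vertexValue j)) dist-in-O

connected : ∀ O → (∀ e → O e ≡ true → odd? e ≡ true) → ∀ n →
            4 * Graph.missingBelow O (n + n) + 4 ≤ n → Connected O (suc n)
connected O O-odd zero few with ≤-trans (m≤n+m 4 (4 * Graph.missingBelow O 0)) few
... | ()
connected O O-odd (suc zero) few with ≤-trans (m≤n+m 4 (4 * Graph.missingBelow O 2)) few
... | s≤s ()
connected O O-odd (suc (suc n)) few i j = walkToTop i ◅◅ reverse (λ {a} {b} → Adj-sym a b) (walkToTop j)
  where
  open Graph O
  open Connectivity O n few
  open Vertices O O-odd (suc M)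
  top : Fin (suc M)
  top = fromℕ M
  Linked : ℕ → Set
  Linked x = (i : Fin (suc M)) → toℕ i ≡ x → Star (Adj O (suc M)) i top
  linked-M : Linked M
  linked-M i i≡M rewrite toℕ-injective (trans i≡M (sym (toℕ-fromℕ M))) = ε
  linked-step : ∀ {x y} → x ≤ M → y ≤ M → adj x y ≡ true → Linked y → Linked x
  linked-step {x} {y} _ y≤M x~y linked-y i i≡x =
    adj⇒Adj {i} {fromℕ< (s≤s y≤M)} (subst₂ (λ a b → adj a b ≡ true) (sym i≡x) (sym (toℕ-fromℕ< (s≤s y≤M))) x~y)
      ◅ linked-y (fromℕ< (s≤s y≤M)) (toℕ-fromℕ< (s≤s y≤M))
  walkToTop : ∀ i → Star (Adj O (suc M)) i top
  walkToTop i = linked-all Linked linked-M linked-step (≤-pred (toℕ<n i)) i refl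

relValues-bounded : ∀ n → All (_< suc (n + n)) (relValues (suc n))
relValues-bounded n = concat⁺ (map⁺ (All.map pairs-bounded vertices))
  where
  IsVertex : ℕ → Set
  IsVertex a = ∃[ i ] i ≤ n × a ≡ 2 * i
  vertices : All IsVertex (evenSet (suc n))
  vertices = map⁺ (applyUpTo⁺₁ id (suc n) (λ {i} i<1+n → i , ≤-pred i<1+n , refl))
  pair-bounded : ∀ {a b} → IsVertex a → IsVertex b → All (_< suc (n + n)) ((a + b) / 2 ∷ ∣ a - b ∣ / 2 ∷ [])
  pair-bounded (i , i≤n , refl) (j , j≤n , refl) rewrite half-sum i j | half-dist i j =
    s≤s (+-mono-≤ i≤n j≤n) ∷ s≤s (≤-trans (∣m-n∣≤m⊔n i j) (≤-trans (⊔-lub i≤n j≤n) (m≤m+n n n))) ∷ []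
  pairs-bounded : ∀ {a} → IsVertex a →
    All (_< suc (n + n)) (concat (map (λ b → (a + b) / 2 ∷ ∣ a - b ∣ / 2 ∷ []) (evenSet (suc n))))
  pairs-bounded a-vertex = concat⁺ (map⁺ (All.map (pair-bounded a-vertex) vertices))

length-ORel≤count : ∀ O n → length (ORel O (suc n)) ≤ count O (suc (n + n))
length-ORel≤count O n = count-unique O (suc (n + n)) (deduplicate-! _≟_ (filterᵇ O (relValues (suc n)))) (deduplicate⁺ _≟_ valid)
  where
  valid : All (λ e → e < suc (n + n) × O e ≡ true) (filterᵇ O (relValues (suc n)))
  valid = All.zipWith id (filter⁺ (T? ∘ O) (relValues-bounded n)
                             , All.map (Equivalence.to Bool.T-≡) (all-filter (T? ∘ O) (relValues (suc n))))

count-odd : ∀ n → count odd? (n + n) ≡ n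
count-odd zero    = refl
count-odd (suc n) rewrite +-suc n n | count-odd n | odd?-double n = trans (cong (_+ 1) (+-identityʳ n)) (+-comm n 1)

count+missing : ∀ O → (∀ e → O e ≡ true → odd? e ≡ true) → ∀ n →
                count O (suc (n + n)) + Graph.missingBelow O (n + n) ≡ n
count+missing O O-odd n = begin
  count O (n + n) + 𝟙 (O (n + n)) + missingBelow (n + n)   ≡⟨ cong (λ b → count O (n + n) + 𝟙 b + missingBelow (n + n)) O-even ⟩
  count O (n + n) + 0 + missingBelow (n + n)               ≡⟨ cong (_+ missingBelow (n + n)) (+-identityʳ _) ⟩
  count O (n + n) + missingBelow (n + n)                   ≡⟨ sumBelow-+ (𝟙 ∘ O) (𝟙 ∘ missing) (n + n) ⟨
  sumBelow (λ t → 𝟙 (O t) + 𝟙 (missing t)) (n + n)         ≡⟨ sumBelow-cong (n + n) odd-split ⟩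
  count odd? (n + n)                                       ≡⟨ count-odd n ⟩
  n                                                        ∎
  where
  open ≡-Reasoning
  open Graph O
  O-even : O (n + n) ≡ false
  O-even with O (n + n) in On
  ... | false = refl
  ... | true  with trans (sym (O-odd (n + n) On)) (odd?-double n)
  ...   | ()
  odd-split : ∀ t → 𝟙 (O t) + 𝟙 (missing t) ≡ 𝟙 (odd? t)
  odd-split t with O t in Ot
  ... | true  rewrite O-odd t Ot = refl
  ... | false with odd? t
  ...   | true  = refl
  ...   | false = refl

few-missing-of-dense : ∀ O → (∀ e → O e ≡ true → odd? e ≡ true) → ∀ n →
  3 * length (evenSet (suc n)) < 4 * length (ORel O (suc n)) → 4 * Graph.missingBelow O (n + n) + 4 ≤ n
few-missing-of-dense O O-odd n dense = +-cancelˡ-≤ (3 * n) _ _ (begin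
  3 * n + (4 * r + 4)              ≡⟨ arith n r ⟩
  suc (3 * suc n) + 4 * r          ≤⟨ +-monoˡ-≤ (4 * r) (subst (λ k → 3 * k < 4 * L) length-A dense) ⟩
  4 * L + 4 * r                    ≡⟨ *-distribˡ-+ 4 L r ⟨
  4 * (L + r)                      ≤⟨ *-monoʳ-≤ 4 (≤-trans (+-monoˡ-≤ r (length-ORel≤count O n)) (≤-reflexive (count+missing O O-odd n))) ⟩
  4 * n                            ≡⟨ arith′ n ⟩
  3 * n + n                        ∎)
  where
  open ≤-Reasoning
  r = Graph.missingBelow O (n + n)
  L = length (ORel O (suc n))
  length-A : length (evenSet (suc n)) ≡ suc n
  length-A = trans (length-map (2 *_) (upTo (suc n))) (length-upTo (suc n))
  arith : ∀ n r → 3 * n + (4 * r + 4) ≡ suc (3 * suc n) + 4 * r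
  arith = solve-∀
  arith′ : ∀ n → 4 * n ≡ 3 * n + n
  arith′ = solve-∀

mainTheorem3 : (m : ℕ) → 1 ≤ m → (O : ℕ → Bool) → IsPositiveOddSet O
    → 3 * length (evenSet m) < 4 * length (ORel O m)
    → Connected O m
mainTheorem3 (suc n) _ O O-positiveOdd dense =
  connected O O-odd n (few-missing-of-dense O O-odd n dense)
  where
  O-odd : ∀ e → O e ≡ true → odd? e ≡ true
  O-odd = positiveOdd⇒odd O-positiveOdd
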